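{- Let $\{\mathbf{v}_i\}_{i \in I} \subseteq \mathbb{B}^k$ be a linearly attached collection. Then there exists a linearly attached collection $\{\mathbf{u}_i\}_{i \in I} \subseteq \mathbb{N}^k$ such that $\mathbf{v}_i = T(\mathbf{u}_i)$ for all $i \in I$, where $T: \mathbb{N}^k \to \mathbb{B}^k$ is the componentwise map $T(u_1,\dots,u_k) = (\varphi(u_1),\dots,\varphi(u_k))$ and $\varphi: \mathbb{N} \to \mathbb{B}$ sends $0$ to $0$ and every positive integer to $1$.
   Context: $\mathbb{N} = \{0,1,2,\dots\}$ with ordinary addition and multiplication, viewed as a semiring. $\mathbb{B} = \{0,1\}$ is the Boolean semiring with $1+1=1$ (i.e. $(\{0,1\},\max,\min)$). For a semiring $S$, $S^k$ has componentwise addition and scalar multiplication. A collection $\{\mathbf{w}_i\}_{i\in I} \subseteq S^k$ is linearly attached if there exist disjoint finite subsets $A, B \subseteq I$, not both empty, and nonzero scalars $(\lambda_a)_{a\in A}$, $(\mu_b)_{b \in B}$ in $S$ such that $\sum_{a\in A} \lambda_a \mathbf{w}_a = \sum_{b \in B} \mu_b \mathbf{w}_b$ (an empty sum being the zero vector). -}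

module Defs where

open import Level using (Level)
open import Algebra.Bundles using (Semiring)
open import Data.Bool using (Bool; true; false)
open import Data.Bool.Properties using (∨-∧-commutativeSemiring)
open import Algebra.Bundles using (CommutativeSemiring)
open import Data.Nat using (ℕ; zero; suc)
open import Data.Nat.Properties using (+-*-semiring)
open import Data.Fin using (Fin)
open import Data.List using (List; []; _∷_; map)
open import Data.List.Relation.Unary.All using (All)
open import Data.List.Relation.Unary.Unique.Propositional using (Unique)
open import Data.List.Membership.Propositional using (_∈_; _∉_)
open import Data.Product using (_×_; _,_; proj₁; proj₂)
open import Data.Sum using (_⊎_)
open import Relation.Binary.PropositionalEquality using (_≢_)
open import Relation.Nullary using (¬_)

𝔹-semiring : Semiring _ _
𝔹-semiring = CommutativeSemiring.semiring ∨-∧-commutativeSemiring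

ℕ-semiring : Semiring _ _
ℕ-semiring = +-*-semiring

module _ {c ℓ : Level} (S : Semiring c ℓ) where
  open Semiring S

  Vec^ : ℕ → Set c
  Vec^ k = Fin k → Carrier

  lincomb : {I : Set} {k : ℕ} → (I → Vec^ k) → List (I × Carrier) → Vec^ k
  lincomb w [] j = 0#
  lincomb w ((a , λa) ∷ L) j = (λa * w a j) + lincomb w L j

  ScaledSubset : (I : Set) → List (I × Carrier) → Set (c Level.⊔ ℓ)
  ScaledSubset I L = Unique (map proj₁ L) × All (λ p → ¬ (proj₂ p ≈ 0#)) L

  record LinearlyAttached {I : Set} {k : ℕ} (w : I → Vec^ k) : Set (c Level.⊔ ℓ) where
    field
      A B        : List (I × Carrier)
      A-ok       : ScaledSubset I A
      B-ok       : ScaledSubset I B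
      disjoint   : ∀ {i} → i ∈ map proj₁ A → i ∉ map proj₁ B
      nonempty   : A ≢ [] ⊎ B ≢ []
      equation   : ∀ j → lincomb w A j ≈ lincomb w B j

φ : ℕ → Bool
φ zero = false
φ (suc _) = true

T : {k : ℕ} → (Fin k → ℕ) → (Fin k → Bool)
T u j = φ (u j)

{-# OPTIONS --safe #-}
module Submission where

open import Defs
open import Data.Nat using (ℕ; zero; suc; _+_; _*_)
open import Data.Nat.Properties using (+-identityʳ; *-distribʳ-+; *-comm)
open import Data.Nat.ListAction using (sum)
open import Data.Fin using (Fin)
open import Data.Fin.Properties using (all?)
open import Data.Bool using (Bool; true; false; _∨_; _∧_; _≟_) renaming (T to IsTrue)
open import Data.Bool.Properties using (T-≡)
open import Data.Product using (Σ; _×_; _,_; proj₁; proj₂)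
open import Data.Sum using (_⊎_; inj₁)
import Data.Sum as Sum
open import Data.List using (List; []; _∷_; map)
open import Data.Bool.ListAction using (any)
open import Data.List.Properties using (map-∘; map-id; map-cong-local)
open import Data.List.Relation.Unary.Any using (Any; here; any?)
open import Data.List.Relation.Unary.Any.Properties using (any⁺)
open import Data.List.Relation.Unary.All using (All; []; _∷_; universal; tabulate)
open import Data.List.Relation.Unary.All.Properties using (map⁺)
open import Data.List.Relation.Unary.AllPairs using ([]; _∷_)
open import Data.List.Relation.Unary.Unique.Propositional using (Unique)
open import Data.List.Membership.Propositional using (_∈_; _∉_; find; lose)
open import Data.Empty using (⊥-elim)
open import Function using (_∘_; Equivalence)
open import Relation.Binary.PropositionalEquality
open ≡-Reasoning
open import Relation.Nullary using (¬_; Dec; yes; no)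

-- Put P = Σ_{a∈A} v_a and Q = Σ_{b∈B} v_b, computed in ℕ^k.  The Boolean relation says
-- exactly that P and Q have the same support.  Lift v_i to v_i ⊙ Q (componentwise product)
-- if v_i equals some v_a, to v_i ⊙ P if it equals some v_b (and to v_i otherwise); the
-- support is unchanged, so T(u_i) = v_i.  If no v_a equals a v_b, then
-- Σ_{a∈A} u_a = P ⊙ Q = Σ_{b∈B} u_b.  Otherwise v_a = v_b forces u_a = u_b, which on its
-- own is a linear attachment since a ∈ A and b ∈ B are distinct.

toℕ : Bool → ℕ
toℕ false = 0
toℕ true  = 1

φ-toℕ : ∀ b → φ (toℕ b) ≡ b
φ-toℕ false = refl
φ-toℕ true  = refl

φ-+ : ∀ m n → φ (m + n) ≡ φ m ∨ φ n
φ-+ zero    n = refl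
φ-+ (suc m) n = refl

φ-toℕ-* : ∀ b n → φ (toℕ b * n) ≡ b ∧ φ n
φ-toℕ-* false n = refl
φ-toℕ-* true  n = cong φ (+-identityʳ n)

φ-sum-toℕ : ∀ {A : Set} (f : A → Bool) xs → φ (sum (map (toℕ ∘ f) xs)) ≡ any f xs
φ-sum-toℕ f []       = refl
φ-sum-toℕ f (x ∷ xs) = begin
  φ (toℕ (f x) + sum (map (toℕ ∘ f) xs))      ≡⟨ φ-+ (toℕ (f x)) _ ⟩
  φ (toℕ (f x)) ∨ φ (sum (map (toℕ ∘ f) xs))  ≡⟨ cong₂ _∨_ (φ-toℕ (f x)) (φ-sum-toℕ f xs) ⟩
  f x ∨ any f xs                              ∎

sum-map-*ʳ : ∀ {A : Set} (f : A → ℕ) c xs → sum (map (λ x → f x * c) xs) ≡ sum (map f xs) * c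
sum-map-*ʳ f c []       = refl
sum-map-*ʳ f c (x ∷ xs) =
  trans (cong (f x * c +_) (sum-map-*ʳ f c xs)) (sym (*-distribʳ-+ c (f x) _))

∧-implied : ∀ {x y} → (IsTrue x → IsTrue y) → x ∧ y ≡ x
∧-implied {false} _   = refl
∧-implied {true}  x⇒y = Equivalence.to T-≡ (x⇒y _)

map-≢[] : ∀ {A B : Set} (f : A → B) {xs} → xs ≢ [] → map f xs ≢ []
map-≢[] f {[]}    xs≢[] _  = xs≢[] refl
map-≢[] f {_ ∷ _} _     ()

lincomb-𝔹 : ∀ {I : Set} {k} (w : I → Fin k → Bool) {L : List (I × Bool)} j →
  All (λ p → proj₂ p ≢ false) L → lincomb 𝔹-semiring w L j ≡ any (λ i → w i j) (map proj₁ L)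
lincomb-𝔹 w                   j []             = refl
lincomb-𝔹 w {(i , false) ∷ L} j (nonzero ∷ _)  = ⊥-elim (nonzero refl)
lincomb-𝔹 w {(i , true)  ∷ L} j (_ ∷ nonzeros) = cong (w i j ∨_) (lincomb-𝔹 w j nonzeros)

unitScalars : {I : Set} → List I → List (I × ℕ)
unitScalars = map (_, 1)

proj₁-unitScalars : ∀ {I : Set} (xs : List I) → map proj₁ (unitScalars xs) ≡ xs
proj₁-unitScalars xs = trans (sym (map-∘ xs)) (map-id xs)

lincomb-unitScalars : ∀ {I : Set} {k} (u : I → Fin k → ℕ) xs j →
  lincomb ℕ-semiring u (unitScalars xs) j ≡ sum (map (λ i → u i j) xs)
lincomb-unitScalars u []       j = refl
lincomb-unitScalars u (i ∷ xs) j = cong₂ _+_ (+-identityʳ (u i j)) (lincomb-unitScalars u xs j)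

attached-unitScalars : ∀ {I : Set} {k} {u : I → Fin k → ℕ} {As Bs : List I} →
  Unique As → Unique Bs → (∀ {i} → i ∈ As → i ∉ Bs) → As ≢ [] ⊎ Bs ≢ [] →
  (∀ j → sum (map (λ a → u a j) As) ≡ sum (map (λ b → u b j) Bs)) →
  LinearlyAttached ℕ-semiring u
attached-unitScalars {u = u} {As} {Bs} unique-As unique-Bs disjoint nonempty balanced = record
  { A        = unitScalars As
  ; B        = unitScalars Bs
  ; A-ok     = scaled unique-As
  ; B-ok     = scaled unique-Bs
  ; disjoint = λ a∈ b∈ → disjoint (subst (_ ∈_) (proj₁-unitScalars As) a∈)
                                   (subst (_ ∈_) (proj₁-unitScalars Bs) b∈)
  ; nonempty = Sum.map (map-≢[] _) (map-≢[] _) nonempty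
  ; equation = λ j → trans (lincomb-unitScalars u As j)
                     (trans (balanced j) (sym (lincomb-unitScalars u Bs j)))
  }
  where
  scaled : ∀ {xs} → Unique xs → ScaledSubset ℕ-semiring _ (unitScalars xs)
  scaled {xs} unique = subst Unique (sym (proj₁-unitScalars xs)) unique
                     , map⁺ (universal (λ _ ()) xs)

attached-pair : ∀ {I : Set} {k} {u : I → Fin k → ℕ} {a b : I} →
  a ≢ b → (∀ j → u a j ≡ u b j) → LinearlyAttached ℕ-semiring u
attached-pair a≢b ua≡ub = attached-unitScalars ([] ∷ []) ([] ∷ [])
  (λ { (here refl) (here refl) → a≢b refl }) (inj₁ (λ ())) (λ j → cong (_+ 0) (ua≡ub j))

module Lifting {I : Set} {k : ℕ} (v : I → Fin k → Bool) (As Bs : List I)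
  (balanced : ∀ j → any (λ a → v a j) As ≡ any (λ b → v b j) Bs) where

  count : List I → Fin k → ℕ
  count L j = sum (map (λ i → toℕ (v i j)) L)

  φ-count : ∀ L j → φ (count L j) ≡ any (λ i → v i j) L
  φ-count L j = φ-sum-toℕ (λ i → v i j) L

  -- Indices in I cannot be compared, so A- and B-membership is decided on the vectors v_i.
  _∈ᵥ_ : (Fin k → Bool) → List I → Set
  x ∈ᵥ L = Any (λ i → v i ≗ x) L

  ∈⇒∈ᵥ : ∀ {i L} → i ∈ L → v i ∈ᵥ L
  ∈⇒∈ᵥ i∈L = lose i∈L (λ _ → refl)

  _∈ᵥ?_ : ∀ x L → Dec (x ∈ᵥ L)
  x ∈ᵥ? L = any? (λ i → all? (λ j → v i j ≟ x j)) L

  weight : (Fin k → Bool) → Fin k → ℕ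
  weight x with x ∈ᵥ? As | x ∈ᵥ? Bs
  ... | yes _ | _     = count Bs
  ... | no _  | yes _ = count As
  ... | no _  | no _  = λ _ → 1

  weight-As : ∀ {x} → x ∈ᵥ As → weight x ≡ count Bs
  weight-As {x} x∈ with x ∈ᵥ? As
  ... | yes _ = refl
  ... | no x∉ = ⊥-elim (x∉ x∈)

  weight-Bs : ∀ {x} → ¬ x ∈ᵥ As → x ∈ᵥ Bs → weight x ≡ count As
  weight-Bs {x} x∉ x∈ with x ∈ᵥ? As | x ∈ᵥ? Bs
  ... | yes x∈′ | _     = ⊥-elim (x∉ x∈′)
  ... | no _    | yes _ = refl
  ... | no _    | no x∉′ = ⊥-elim (x∉′ x∈)

  occurs-any : ∀ {x} L j → x ∈ᵥ L → IsTrue (x j) → IsTrue (any (λ i → v i j) L)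
  occurs-any L j x∈L xj =
    let i , i∈L , vi≗x = find x∈L
    in any⁺ (λ i → v i j) (lose i∈L (subst IsTrue (sym (vi≗x j)) xj))

  -- φ ∘ P and φ ∘ Q are the two sides of the Boolean relation, so they coincide.
  weight-positive : ∀ x j → IsTrue (x j) → IsTrue (φ (weight x j))
  weight-positive x j xj with x ∈ᵥ? As | x ∈ᵥ? Bs
  ... | yes x∈ | _      = subst IsTrue (trans (balanced j) (sym (φ-count Bs j))) (occurs-any As j x∈ xj)
  ... | no _   | yes x∈ = subst IsTrue (trans (sym (balanced j)) (sym (φ-count As j))) (occurs-any Bs j x∈ xj)
  ... | no _   | no _   = _

  lift : I → Fin k → ℕ
  lift i j = toℕ (v i j) * weight (v i) j

  T-lift : ∀ i j → T (lift i) j ≡ v i j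
  T-lift i j = trans (φ-toℕ-* (v i j) (weight (v i) j)) (∧-implied (weight-positive (v i) j))

  lift-As : ∀ {i} → v i ∈ᵥ As → ∀ j → lift i j ≡ toℕ (v i j) * count Bs j
  lift-As {i} vi∈ j = cong (λ w → toℕ (v i j) * w j) (weight-As vi∈)

  lift-Bs : ∀ {i} → ¬ v i ∈ᵥ As → v i ∈ᵥ Bs → ∀ j → lift i j ≡ toℕ (v i j) * count As j
  lift-Bs {i} vi∉ vi∈ j = cong (λ w → toℕ (v i j) * w j) (weight-Bs vi∉ vi∈)

  sum-lift-As : ∀ j → sum (map (λ a → lift a j) As) ≡ count As j * count Bs j
  sum-lift-As j = begin
    sum (map (λ a → lift a j) As)                   ≡⟨ cong sum (map-cong-local (tabulate λ a∈ → lift-As (∈⇒∈ᵥ a∈) j)) ⟩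
    sum (map (λ a → toℕ (v a j) * count Bs j) As)  ≡⟨ sum-map-*ʳ (λ a → toℕ (v a j)) (count Bs j) As ⟩
    count As j * count Bs j                         ∎

  sum-lift-Bs : (∀ {b} → b ∈ Bs → ¬ v b ∈ᵥ As) →
    ∀ j → sum (map (λ b → lift b j) Bs) ≡ count Bs j * count As j
  sum-lift-Bs b∉ j = begin
    sum (map (λ b → lift b j) Bs)                   ≡⟨ cong sum (map-cong-local (tabulate λ b∈ → lift-Bs (b∉ b∈) (∈⇒∈ᵥ b∈) j)) ⟩
    sum (map (λ b → toℕ (v b j) * count As j) Bs)  ≡⟨ sum-map-*ʳ (λ b → toℕ (v b j)) (count As j) Bs ⟩
    count Bs j * count As j                         ∎

  lift-attached : Unique As → Unique Bs → (∀ {i} → i ∈ As → i ∉ Bs) → As ≢ [] ⊎ Bs ≢ [] →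
    LinearlyAttached ℕ-semiring lift
  lift-attached unique-As unique-Bs disjoint nonempty with any? (_∈ᵥ? As ∘ v) Bs
  ... | yes shared =
    let b , b∈Bs , vb∈ = find shared
        a , a∈As , va≗vb = find vb∈
    in attached-pair (λ a≡b → disjoint a∈As (subst (_∈ Bs) (sym a≡b) b∈Bs)) λ j → begin
         lift a j                  ≡⟨ lift-As (∈⇒∈ᵥ a∈As) j ⟩
         toℕ (v a j) * count Bs j  ≡⟨ cong (λ c → toℕ c * count Bs j) (va≗vb j) ⟩
         toℕ (v b j) * count Bs j  ≡⟨ lift-As vb∈ j ⟨
         lift b j                  ∎
  ... | no unshared = attached-unitScalars unique-As unique-Bs disjoint nonempty λ j →
    trans (sum-lift-As j) (trans (*-comm (count As j) (count Bs j)) (sym (sum-lift-Bs b∉ j)))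
    where
    b∉ : ∀ {b} → b ∈ Bs → ¬ v b ∈ᵥ As
    b∉ b∈ vb∈ = unshared (lose b∈ vb∈)

theorem3p15 : (I : Set) (k : ℕ) (v : I → Fin k → Bool) →
    LinearlyAttached 𝔹-semiring v →
    Σ (I → Fin k → ℕ) (λ u → LinearlyAttached ℕ-semiring u × (∀ i j → v i j ≡ T (u i) j))
theorem3p15 I k v attached =
  lift , lift-attached (proj₁ A-ok) (proj₁ B-ok) disjoint (Sum.map (map-≢[] _) (map-≢[] _) nonempty)
       , λ i j → sym (T-lift i j)
  where
  open LinearlyAttached attached
  As Bs : List I
  As = map proj₁ A
  Bs = map proj₁ B

  balanced : ∀ j → any (λ a → v a j) As ≡ any (λ b → v b j) Bs
  balanced j = begin
    any (λ a → v a j) As      ≡⟨ lincomb-𝔹 v j (proj₂ A-ok) ⟨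
    lincomb 𝔹-semiring v A j  ≡⟨ equation j ⟩
    lincomb 𝔹-semiring v B j  ≡⟨ lincomb-𝔹 v j (proj₂ B-ok) ⟩
    any (λ b → v b j) Bs      ∎

  open Lifting v As Bs balanced
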